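{- Let $k\in\mathbb{N}$ and $r\in[k]$. The number of $k$-permutation matrices that have an $r$-repetition is at most $2k^2\cdot k!/r!$. Consequently, the number of $k$-permutation matrices that are not scattered is $o(k!)$ as $k\to\infty$.
   Context: A $k$-permutation matrix is a $k\times k$ binary matrix with exactly one $1$-entry in every row and every column. A $1$-entry is identified with its position $(i,j)$; the distance vector from $(i_1,j_1)$ to $(i_2,j_2)$ is $(i_2-i_1,j_2-j_1)$. A vector is $r$-repeated in a permutation matrix $P$ if it occurs as the distance vector of at least $r$ pairs of $1$-entries of $P$; $P$ has an $r$-repetition if some vector is $r$-repeated in $P$, and is $r$-repetition-free otherwise. A $k$-permutation matrix is scattered if it is $r$-repetition-free for every $r\ge 4\log_2 k/\log_2\log_2 k$. -}

module Defs where

open import Data.Bool using (Bool; true)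
open import Data.Nat using (ℕ; zero; suc; _+_; _*_; _^_; _≤_; _<_)
open import Data.Integer as ℤ using (ℤ)
open import Data.Fin using (Fin; toℕ)
open import Data.Vec using (Vec; lookup)
open import Data.List using (List; length)
open import Data.List.Relation.Unary.All using (All)
open import Data.List.Relation.Unary.Unique.Propositional using (Unique)
open import Data.Product using (Σ; ∃; ∃-syntax; _×_; _,_)
open import Relation.Nullary using (¬_)
open import Relation.Binary.PropositionalEquality using (_≡_; _≢_)

Matrix : ℕ → Set
Matrix k = Vec (Vec Bool k) k

-- Positions (i , j) : row i, column j.
Pos : ℕ → Set
Pos k = Fin k × Fin k

IsOne : ∀ {k} → Matrix k → Pos k → Set
IsOne M (i , j) = lookup (lookup M i) j ≡ true

IsPermMatrix : ∀ {k} → Matrix k → Set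
IsPermMatrix {k} M =
  (∀ (i : Fin k) → ∃[ j ] (IsOne M (i , j) × (∀ j′ → IsOne M (i , j′) → j′ ≡ j)))
  × (∀ (j : Fin k) → ∃[ i ] (IsOne M (i , j) × (∀ i′ → IsOne M (i′ , j) → i′ ≡ i)))

toℤ : ∀ {k} → Fin k → ℤ
toℤ i = ℤ.+ (toℕ i)

dist : ∀ {k} → Pos k → Pos k → ℤ × ℤ
dist (i₁ , j₁) (i₂ , j₂) = (toℤ i₂ ℤ.- toℤ i₁ , toℤ j₂ ℤ.- toℤ j₁)

PairWith : ∀ {k} → Matrix k → ℤ × ℤ → Pos k × Pos k → Set
PairWith M v (p , q) = IsOne M p × IsOne M q × p ≢ q × dist p q ≡ v

RRepeated : ∀ {k} → Matrix k → ℕ → ℤ × ℤ → Set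
RRepeated {k} M r v =
  ∃[ ps ] (Unique {A = Pos k × Pos k} ps × All (PairWith M v) ps × r ≤ length ps)

HasRepetition : ∀ {k} → Matrix k → ℕ → Set
HasRepetition M r = ∃[ v ] RRepeated M r v

RepetitionFree : ∀ {k} → Matrix k → ℕ → Set
RepetitionFree M r = ¬ HasRepetition M r

-- ThresholdOK k r  encodes the real inequality  r ≥ 4 log₂ k / log₂ log₂ k.
ThresholdOK : ℕ → ℕ → Set
ThresholdOK k r = ∀ (a b : ℕ) → 0 < b → a ^ r < k ^ 4 * b ^ r → 2 ^ a ≤ k ^ b

Scattered : ∀ {k} → Matrix k → Set
Scattered {k} M = ∀ (r : ℕ) → ThresholdOK k r → RepetitionFree M r

-- "the number of k×k matrices satisfying P is at most N":
-- every duplicate-free list of such matrices has length ≤ N.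
CountAtMost : (k : ℕ) → (Matrix k → Set) → ℕ → Set
CountAtMost k P N = ∀ (L : List (Matrix k)) → Unique L → All P L → length L ≤ N

-- After reversing all pairs, an r-repetition of a permutation matrix M has a vector (A, b)
-- with b > 0, and the right ends of its pairs lie in r distinct rows.  Order these rows as P
-- (r! ways) and encode (M, P) by (A, b, Λ), where Λ is P followed by the other rows of M in
-- column order, a permutation of [0, k).  The code determines M and P: reading the columns
-- from left to right, the row of column x is (the row of column x − b) + A if that belongs to P,
-- and otherwise the next row of the tail of Λ.  There are 2k · k · k! codes, so r! · #M ≤ 2k² · k!.
--
-- For the second part let L = ⌊log₂ k⌋, Q = ⌊log₂ L⌋ and r₀ = ⌈4L / (Q + 1)⌉.  Every r < r₀ is
-- below the threshold, since (L + 1) ^ r < k ^ 4 although L + 1 > log₂ k; so a matrix that is not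
-- scattered has an r₀-repetition.  On the other hand r₀! ≥ 2 ^ (3L) ≥ (n + 1) · 2k² for large k.

module Submission where

open import Data.Bool using (true; false)
import Data.Bool.Properties as Bool
open import Data.Nat
open import Data.Nat.Properties
open import Data.Nat.DivMod using (m/n*n≤m; m%n<n; m≡m%n+[m/n]*n)
open import Data.Nat.Tactic.RingSolver using (solve-∀)
open import Data.Integer as ℤ using (ℤ; +_; -[1+_]; -_; _-_)
open import Data.Integer.Properties as ℤ using (m-n≡m⊖n; ⊖-≥; ⊖-<)
import Data.Integer.Tactic.RingSolver as ℤ-Solver
open import Data.Fin using (Fin; toℕ; fromℕ<)
open import Data.Fin.Properties using (any?; toℕ-injective; toℕ<n; toℕ-fromℕ<; fromℕ<-toℕ)
open import Data.Vec using (lookup; tabulate)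
open import Data.Vec.Properties using (tabulate∘lookup; tabulate-cong)
open import Data.List
  using (List; []; _∷_; _++_; [_]; length; map; filter; concatMap; removeAt; upTo; take; cartesianProduct)
open import Data.List.Properties
  using ( length-map; length-++; length-removeAt′; length-upTo; length-take
        ; filter-accept; filter-reject; filter-all; ∷-injective; ∷-injectiveˡ)
open import Data.List.Relation.Unary.All as All using (All; []; _∷_)
open import Data.List.Relation.Unary.All.Properties as All using ()
open import Data.List.Relation.Unary.Any as Any using (here; there; index)
open import Data.List.Relation.Unary.AllPairs as AllPairs using ()
open import Data.List.Relation.Unary.AllPairs.Properties as AllPairs using ()
open import Data.List.Relation.Unary.Unique.Propositional using (Unique; []; _∷_)
open import Data.List.Relation.Unary.Unique.Propositional.Properties as Unique using (upTo⁺)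
open import Data.List.Membership.Propositional using (_∈_; _∉_; find)
open import Data.List.Membership.DecPropositional _≟_ using (_∈?_; _∉?_)
open import Data.List.Membership.Propositional.Properties
  using ( ∈-map⁺; ∈-map⁻; ∈-filter⁺; ∈-filter⁻; ∈-concatMap⁺; ∈-concatMap⁻
        ; ∈-++⁺ˡ; ∈-++⁺ʳ; ∈-++⁻; ∈-upTo⁺; ∈-upTo⁻; ∈-cartesianProduct⁺)
open import Data.List.Relation.Binary.Subset.Propositional using (_⊆_)
open import Data.List.Relation.Binary.Disjoint.Propositional using (Disjoint)
open import Data.Product as Product using (∃-syntax; _×_; _,_; proj₁; proj₂; swap)
open import Data.Sum using (inj₁; inj₂)
open import Function using (_∘_)
open import Relation.Nullary using (¬_; ¬?; Dec; yes; no; contradiction)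
open import Relation.Nullary.Decidable using (decidable-stable)
open import Relation.Binary.Definitions using (DecidableEquality)
open import Relation.Binary.PropositionalEquality using (_≡_; _≢_; refl; sym; trans; cong; cong₂; subst; module ≡-Reasoning)
open import Defs

private
  variable
    S T : Set

-- Counting duplicate-free lists

∈-removeAt⁺ : ∀ {x y : S} {ys} (y∈ys : y ∈ ys) → x ∈ ys → x ≢ y → x ∈ removeAt ys (index y∈ys)
∈-removeAt⁺ (here refl) (here refl) x≢y = contradiction refl x≢y
∈-removeAt⁺ (here refl) (there x∈ys) x≢y = x∈ys
∈-removeAt⁺ (there y∈ys) (here refl) x≢y = here refl
∈-removeAt⁺ (there y∈ys) (there x∈ys) x≢y = there (∈-removeAt⁺ y∈ys x∈ys x≢y)

Unique-⊆⇒length≤ : ∀ {xs ys : List S} → Unique xs → xs ⊆ ys → length xs ≤ length ys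
Unique-⊆⇒length≤ {xs = []} _ _ = z≤n
Unique-⊆⇒length≤ {xs = x ∷ xs} {ys} (x∉xs ∷ xs!) xs⊆ys =
  ≤-trans (s≤s (Unique-⊆⇒length≤ xs! xs⊆ys─x)) (≤-reflexive (sym (length-removeAt′ ys (index x∈ys))))
  where
  x∈ys : x ∈ ys
  x∈ys = xs⊆ys (here refl)
  xs⊆ys─x : xs ⊆ removeAt ys (index x∈ys)
  xs⊆ys─x z∈xs = ∈-removeAt⁺ x∈ys (xs⊆ys (there z∈xs)) (λ { refl → All.lookup x∉xs z∈xs refl })

InjectiveOn : (S → T) → List S → Set
InjectiveOn f xs = ∀ {x y} → x ∈ xs → y ∈ xs → f x ≡ f y → x ≡ y

Unique-map⁺ : ∀ {f : S → T} {xs} → InjectiveOn f xs → Unique xs → Unique (map f xs)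
Unique-map⁺ {xs = []} _ [] = []
Unique-map⁺ {xs = x ∷ xs} f-inj (x∉xs ∷ xs!) =
  All.map⁺ (All.tabulate λ y∈xs fx≡fy → All.lookup x∉xs y∈xs (f-inj (here refl) (there y∈xs) fx≡fy))
  ∷ Unique-map⁺ (λ x∈ y∈ → f-inj (there x∈) (there y∈)) xs!

length≤-by-injection : ∀ (f : S → T) {xs ys} → Unique xs → InjectiveOn f xs →
                       (∀ {x} → x ∈ xs → f x ∈ ys) → length xs ≤ length ys
length≤-by-injection f {xs} {ys} xs! f-inj f-into = begin
  length xs         ≡⟨ length-map f xs ⟨
  length (map f xs) ≤⟨ Unique-⊆⇒length≤ (Unique-map⁺ f-inj xs!) fxs⊆ys ⟩
  length ys         ∎
  where
  open ≤-Reasoning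
  fxs⊆ys : map f xs ⊆ ys
  fxs⊆ys fx∈ with _ , x∈xs , refl ← ∈-map⁻ f fx∈ = f-into x∈xs

++-injective : ∀ {xs ys zs ws : List S} → length xs ≡ length ys → xs ++ zs ≡ ys ++ ws → xs ≡ ys × zs ≡ ws
++-injective {xs = []}     {[]}     _ same = refl , same
++-injective {xs = x ∷ xs} {y ∷ ys} {zs} {ws} |xs|≡|ys| same
  with refl , same' ← ∷-injective same
  with refl , refl ← ++-injective {xs = xs} {ys} {zs} {ws} (suc-injective |xs|≡|ys|) same' =
  refl , refl

length-concatMap : ∀ (f : S → List T) c xs → (∀ {x} → x ∈ xs → length (f x) ≡ c) →
                   length (concatMap f xs) ≡ length xs * c
length-concatMap f c [] _ = refl
length-concatMap f c (x ∷ xs) lengths = begin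
  length (f x ++ concatMap f xs)         ≡⟨ length-++ (f x) ⟩
  length (f x) + length (concatMap f xs) ≡⟨ cong₂ _+_ (lengths (here refl)) (length-concatMap f c xs (lengths ∘ there)) ⟩
  c + length xs * c                      ∎
  where open ≡-Reasoning

length-cartesianProduct : ∀ (xs : List S) (ys : List T) →
                          length (cartesianProduct xs ys) ≡ length xs * length ys
length-cartesianProduct []       ys = refl
length-cartesianProduct (x ∷ xs) ys = begin
  length (map (x ,_) ys ++ cartesianProduct xs ys)
    ≡⟨ length-++ (map (x ,_) ys) ⟩
  length (map (x ,_) ys) + length (cartesianProduct xs ys)
    ≡⟨ cong₂ _+_ (length-map (x ,_) ys) (length-cartesianProduct xs ys) ⟩
  length ys + length xs * length ys
    ∎
  where open ≡-Reasoning

module Arrangements {A : Set} (_≟_ : DecidableEquality A) where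

  remove : A → List A → List A
  remove y = filter (λ z → ¬? (y ≟ z))

  ∈-remove⁺ : ∀ {y z xs} → z ∈ xs → y ≢ z → z ∈ remove y xs
  ∈-remove⁺ = ∈-filter⁺ (λ z → ¬? (_ ≟ z))

  ∈-remove⁻ : ∀ {y z xs} → z ∈ remove y xs → z ∈ xs × y ≢ z
  ∈-remove⁻ = ∈-filter⁻ (λ z → ¬? (_ ≟ z))

  remove-unique : ∀ {y xs} → Unique xs → Unique (remove y xs)
  remove-unique = Unique.filter⁺ (λ z → ¬? (_ ≟ z))

  length-remove : ∀ {y xs} → Unique xs → y ∈ xs → suc (length (remove y xs)) ≡ length xs
  length-remove {y} {y ∷ xs} (y∉xs ∷ _) (here refl) =
    cong (suc ∘ length) (trans (filter-reject (λ z → ¬? (y ≟ z)) (λ y≢y → y≢y refl))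
                               (filter-all (λ z → ¬? (y ≟ z)) y∉xs))
  length-remove {y} {x ∷ xs} (x∉xs ∷ xs!) (there y∈xs) =
    trans (cong (suc ∘ length) (filter-accept (λ z → ¬? (y ≟ z)) (λ { refl → All.lookup x∉xs y∈xs refl })))
          (cong suc (length-remove xs! y∈xs))

  arrangements : ℕ → List A → List (List A)
  arrangements zero    xs = [ [] ]
  arrangements (suc m) xs = concatMap (λ y → map (y ∷_) (arrangements m (remove y xs))) xs

  length-arrangements : ∀ m {xs} → Unique xs → length xs ≡ m → length (arrangements m xs) ≡ m !
  length-arrangements zero    _   _        = refl
  length-arrangements (suc m) {xs} xs! |xs|≡1+m = begin
    length (arrangements (suc m) xs) ≡⟨ length-concatMap _ (m !) xs lengths ⟩
    length xs * m !                  ≡⟨ cong (_* m !) |xs|≡1+m ⟩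
    suc m * m !                      ∎
    where
    open ≡-Reasoning
    lengths : ∀ {y} → y ∈ xs → length (map (y ∷_) (arrangements m (remove y xs))) ≡ m !
    lengths {y} y∈xs = trans (length-map (y ∷_) (arrangements m (remove y xs)))
      (length-arrangements m (remove-unique xs!)
        (suc-injective (trans (length-remove xs! y∈xs) |xs|≡1+m)))

  arrangements-unique : ∀ m {xs} → Unique xs → Unique (arrangements m xs)
  arrangements-unique zero    _   = [] ∷ []
  arrangements-unique (suc m) xs! =
    Unique.concat⁺ (All.map⁺ (All.tabulate λ _ →
                      Unique.map⁺ (λ { refl → refl }) (arrangements-unique m (remove-unique xs!))))
                   (AllPairs.map⁺ (AllPairs.map disjoint xs!))
    where
    disjoint : ∀ {y y' X Y} → y ≢ y' → Disjoint (map (y ∷_) X) (map (y' ∷_) Y)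
    disjoint y≢y' (Λ∈X , Λ∈Y)
      with _ , _ , refl ← ∈-map⁻ _ Λ∈X | _ , _ , eq ← ∈-map⁻ _ Λ∈Y = y≢y' (∷-injectiveˡ eq)

  ∈-arrangements⁺ : ∀ m {xs Λ} → Unique Λ → Λ ⊆ xs → length Λ ≡ m → Λ ∈ arrangements m xs
  ∈-arrangements⁺ zero    {Λ = []}    _          _     _ = here refl
  ∈-arrangements⁺ (suc m) {xs} {y ∷ Λ} (y∉Λ ∷ Λ!) Λ⊆xs |Λ|≡1+m =
    ∈-concatMap⁺ _ (Any.map (λ { refl → ∈-map⁺ (y ∷_) Λ∈arrangements }) (Λ⊆xs (here refl)))
    where
    Λ∈arrangements : Λ ∈ arrangements m (remove y xs)
    Λ∈arrangements = ∈-arrangements⁺ m Λ!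
      (λ z∈Λ → ∈-remove⁺ (Λ⊆xs (there z∈Λ)) (All.lookup y∉Λ z∈Λ))
      (suc-injective |Λ|≡1+m)

  ∈-arrangements⁻ : ∀ m {xs Λ} → Λ ∈ arrangements m xs → Unique Λ × Λ ⊆ xs × length Λ ≡ m
  ∈-arrangements⁻ zero    (here refl) = [] , (λ ()) , refl
  ∈-arrangements⁻ (suc m) {xs} Λ∈
    with y , y∈xs , Λ∈block ← find (∈-concatMap⁻ (λ y → map (y ∷_) (arrangements m (remove y xs))) {xs} Λ∈)
    with Λ' , Λ'∈ , refl ← ∈-map⁻ (y ∷_) Λ∈block
    with Λ'! , Λ'⊆ , |Λ'|≡m ← ∈-arrangements⁻ m Λ'∈ =
      All.tabulate (proj₂ ∘ ∈-remove⁻ {xs = xs} ∘ Λ'⊆) ∷ Λ'! ,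
      (λ { (here refl) → y∈xs ; (there z∈Λ') → proj₁ (∈-remove⁻ (Λ'⊆ z∈Λ')) }) ,
      cong suc |Λ'|≡m

open Arrangements _≟_

-- Encoding a permutation by marked rows

record Permutes (k : ℕ) (ρ : ℕ → ℕ) : Set where
  field
    maps-below : ∀ {x} → x < k → ρ x < k
    injective  : ∀ {x y} → ρ x ≡ ρ y → x ≡ y
    covers     : ∀ {i} → i < k → ∃[ x ] (x < k × ρ x ≡ i)

range : ℕ → ℕ → List ℕ
range x zero    = []
range x (suc n) = x ∷ range (suc x) n

∈-range⁻ : ∀ {x n y} → y ∈ range x n → x ≤ y × y < x + n
∈-range⁻ {x} {suc n} (here refl) = ≤-refl , m<m+n x z<s
∈-range⁻ {x} {suc n} {y} (there y∈) with x<y , y<x+n ← ∈-range⁻ y∈ =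
  <⇒≤ x<y , subst (y <_) (sym (+-suc x n)) y<x+n

∈-range⁺ : ∀ {x n y} → x ≤ y → y < x + n → y ∈ range x n
∈-range⁺ {x} {zero} x≤y y<x+0 = contradiction (≤-<-trans x≤y (subst (_ <_) (+-identityʳ x) y<x+0)) (<-irrefl refl)
∈-range⁺ {x} {suc n} {y} x≤y y<x+1+n with m≤n⇒m<n∨m≡n x≤y
... | inj₁ x<y  = there (∈-range⁺ x<y (subst (y <_) (+-suc x n) y<x+1+n))
... | inj₂ refl = here refl

range-unique : ∀ x n → Unique (range x n)
range-unique x zero    = []
range-unique x (suc n) = All.tabulate (λ y∈ → <⇒≢ (proj₁ (∈-range⁻ y∈))) ∷ range-unique (suc x) n

module Encoding (k b : ℕ) (Linked : ℕ → ℕ → Set) where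

  PairEnd : (ℕ → ℕ) → ℕ → Set
  PairEnd ρ i = ∃[ j ] (j + b < k × ρ (j + b) ≡ i × Linked (ρ j) i)

  unmarked : (ℕ → ℕ) → List ℕ → ℕ → ℕ → List ℕ
  unmarked ρ P x n = filter (_∉? P) (map ρ (range x n))

  encode : (ℕ → ℕ) → List ℕ → List ℕ
  encode ρ P = P ++ unmarked ρ P 0 k

  ∈-unmarked⁻ : ∀ ρ P x n {i} → i ∈ unmarked ρ P x n → i ∉ P × ∃[ y ] (y ∈ range x n × ρ y ≡ i)
  ∈-unmarked⁻ ρ P x n i∈ with i∈map , i∉P ← ∈-filter⁻ (_∉? P) {xs = map ρ (range x n)} i∈
    with y , y∈range , refl ← ∈-map⁻ ρ i∈map = i∉P , y , y∈range , refl

  ∈-unmarked⁺ : ∀ ρ P {x n y} → y ∈ range x n → ρ y ∉ P → ρ y ∈ unmarked ρ P x n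
  ∈-unmarked⁺ ρ P y∈range = ∈-filter⁺ (_∉? P) (∈-map⁺ ρ y∈range)

  module _ {ρ : ℕ → ℕ} (ρ-perm : Permutes k ρ) {P : List ℕ} where
    open Permutes ρ-perm

    encode-unique : Unique P → Unique (encode ρ P)
    encode-unique P! = Unique.++⁺ P!
      (Unique.filter⁺ (_∉? P) (Unique-map⁺ (λ _ _ → injective) (range-unique 0 k)))
      (λ (i∈P , i∈unmarked) → proj₁ (∈-unmarked⁻ ρ P 0 k i∈unmarked) i∈P)

    encode⊆upTo : All (PairEnd ρ) P → encode ρ P ⊆ upTo k
    encode⊆upTo ends i∈encode with ∈-++⁻ P i∈encode
    ... | inj₁ i∈P with _ , j+b<k , refl , _ ← All.lookup ends i∈P = ∈-upTo⁺ (maps-below j+b<k)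
    ... | inj₂ i∈unmarked with _ , x , x∈range , refl ← ∈-unmarked⁻ ρ P 0 k i∈unmarked =
      ∈-upTo⁺ (maps-below (proj₂ (∈-range⁻ x∈range)))

    upTo⊆encode : upTo k ⊆ encode ρ P
    upTo⊆encode i∈upTo with x , x<k , refl ← covers (∈-upTo⁻ i∈upTo) | ρ x ∈? P
    ... | yes ρx∈P = ∈-++⁺ˡ ρx∈P
    ... | no  ρx∉P = ∈-++⁺ʳ P (∈-unmarked⁺ ρ P (∈-range⁺ z≤n x<k) ρx∉P)

    length-encode : All (PairEnd ρ) P → Unique P → length (encode ρ P) ≡ k
    length-encode ends P! = ≤-antisym
      (subst (length (encode ρ P) ≤_) (length-upTo k) (Unique-⊆⇒length≤ (encode-unique P!) (encode⊆upTo ends)))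
      (subst (_≤ length (encode ρ P)) (length-upTo k) (Unique-⊆⇒length≤ (upTo⁺ k) upTo⊆encode))

    encode∈arrangements : All (PairEnd ρ) P → Unique P → encode ρ P ∈ arrangements k (upTo k)
    encode∈arrangements ends P! =
      ∈-arrangements⁺ k (encode-unique P!) (encode⊆upTo ends) (length-encode ends P!)

  module _ (linked-unique : ∀ {y y' i} → Linked y i → Linked y' i → y ≡ y') (b>0 : 0 < b) where

    -- The left partner of a marked row sits b columns earlier, so it is already known.
    marked-determined : ∀ {ρ ρ' P} → Permutes k ρ → Permutes k ρ' → All (PairEnd ρ) P → All (PairEnd ρ') P →
                        ∀ {x} → (∀ {y} → y < x → ρ y ≡ ρ' y) → ρ x ∈ P → ρ' x ≡ ρ x
    marked-determined {ρ} {ρ'} ρ-perm ρ'-perm ends ends' {x} agree ρx∈P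
      with j  , _ , ρ[j+b]≡ρx   , linked  ← All.lookup ends ρx∈P
         | j' , _ , ρ'[j'+b]≡ρx , linked' ← All.lookup ends' ρx∈P = begin
      ρ' x        ≡⟨ cong ρ' j+b≡x ⟨
      ρ' (j + b)  ≡⟨ cong (λ z → ρ' (z + b)) j'≡j ⟨
      ρ' (j' + b) ≡⟨ ρ'[j'+b]≡ρx ⟩
      ρ x         ∎
      where
      open ≡-Reasoning
      j+b≡x : j + b ≡ x
      j+b≡x = Permutes.injective ρ-perm ρ[j+b]≡ρx
      j'≡j : j' ≡ j
      j'≡j = Permutes.injective ρ'-perm
        (trans (linked-unique linked' linked) (agree (subst (j <_) j+b≡x (m<m+n j b>0))))

    module _ {ρ ρ' : ℕ → ℕ} {P : List ℕ} (ρ-perm : Permutes k ρ) (ρ'-perm : Permutes k ρ')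
             (ends : All (PairEnd ρ) P) (ends' : All (PairEnd ρ') P) where

      unmarked-head : ∀ {x n} → (∀ {y} → y < x → ρ y ≡ ρ' y) →
                      unmarked ρ P x (suc n) ≡ unmarked ρ' P x (suc n) →
                      ρ x ≡ ρ' x × unmarked ρ P (suc x) n ≡ unmarked ρ' P (suc x) n
      unmarked-head {x} {n} agree same = by-cases (ρ x ∈? P) (ρ' x ∈? P)
        where
        by-cases : Dec (ρ x ∈ P) → Dec (ρ' x ∈ P) →
                   ρ x ≡ ρ' x × unmarked ρ P (suc x) n ≡ unmarked ρ' P (suc x) n
        by-cases (yes ρx∈P) (yes ρ'x∈P) =
          sym (marked-determined ρ-perm ρ'-perm ends ends' agree ρx∈P) ,
          trans (sym (filter-reject (_∉? P) {xs = map ρ (range (suc x) n)} (λ ∉ → ∉ ρx∈P)))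
                (trans same (filter-reject (_∉? P) {xs = map ρ' (range (suc x) n)} (λ ∉ → ∉ ρ'x∈P)))
        by-cases (yes ρx∈P) (no ρ'x∉P) =
          contradiction (subst (_∈ P) (sym (marked-determined ρ-perm ρ'-perm ends ends' agree ρx∈P)) ρx∈P) ρ'x∉P
        by-cases (no ρx∉P) (yes ρ'x∈P) =
          contradiction (subst (_∈ P) (sym (marked-determined ρ'-perm ρ-perm ends' ends (sym ∘ agree) ρ'x∈P)) ρ'x∈P) ρx∉P
        by-cases (no ρx∉P) (no ρ'x∉P) =
          ∷-injective (trans (sym (filter-accept (_∉? P) {xs = map ρ (range (suc x) n)} ρx∉P))
                             (trans same (filter-accept (_∉? P) {xs = map ρ' (range (suc x) n)} ρ'x∉P)))

      unmarked-determines : ∀ n {x} → (∀ {y} → y < x → ρ y ≡ ρ' y) →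
                            unmarked ρ P x n ≡ unmarked ρ' P x n → ∀ {y} → y < x + n → ρ y ≡ ρ' y
      unmarked-determines zero {x} agree _ {y} y<x+0 = agree (subst (y <_) (+-identityʳ x) y<x+0)
      unmarked-determines (suc n) {x} agree same {y} y<x+1+n =
        unmarked-determines n agree' (proj₂ (unmarked-head agree same)) (subst (y <_) (+-suc x n) y<x+1+n)
        where
        agree' : ∀ {y} → y < suc x → ρ y ≡ ρ' y
        agree' y<1+x with m≤n⇒m<n∨m≡n (s≤s⁻¹ y<1+x)
        ... | inj₁ y<x  = agree y<x
        ... | inj₂ refl = proj₁ (unmarked-head agree same)

    encode-injective : ∀ {ρ ρ' P P'} → Permutes k ρ → Permutes k ρ' → All (PairEnd ρ) P → All (PairEnd ρ') P' →
                       length P ≡ length P' → encode ρ P ≡ encode ρ' P' →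
                       P ≡ P' × (∀ {y} → y < k → ρ y ≡ ρ' y)
    encode-injective {ρ} {ρ'} {P} {P'} ρ-perm ρ'-perm ends ends' |P|≡|P'| same
      with refl , same-unmarked ← ++-injective {xs = P} {P'} {unmarked ρ P 0 k} {unmarked ρ' P' 0 k} |P|≡|P'| same =
      refl , unmarked-determines ρ-perm ρ'-perm ends ends' k (λ ()) same-unmarked

-- Permutation matrices and their repetitions

-- For a column without a 1-entry the junk row is the column index itself.
rowOf : ∀ {k} → Matrix k → Fin k → Fin k
rowOf M j with any? (λ i → lookup (lookup M i) j Bool.≟ true)
... | yes (i , _) = i
... | no  _       = j

module _ {k : ℕ} (M : Matrix k) (pm : IsPermMatrix M) where

  column-unique : ∀ {i i' j} → IsOne M (i , j) → IsOne M (i' , j) → i ≡ i'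
  column-unique {j = j} one one' = let _ , _ , unique = proj₂ pm j in trans (unique _ one) (sym (unique _ one'))

  row-unique : ∀ {i j j'} → IsOne M (i , j) → IsOne M (i , j') → j ≡ j'
  row-unique {i} one one' = let _ , _ , unique = proj₁ pm i in trans (unique _ one) (sym (unique _ one'))

  isOne-rowOf : ∀ j → IsOne M (rowOf M j , j)
  isOne-rowOf j with any? (λ i → lookup (lookup M i) j Bool.≟ true)
  ... | yes (_ , one) = one
  ... | no  none      = let i , one , _ = proj₂ pm j in contradiction (i , one) none

  isOne⇒rowOf : ∀ {i j} → IsOne M (i , j) → i ≡ rowOf M j
  isOne⇒rowOf {j = j} one = column-unique one (isOne-rowOf j)

  rowOf-injective : ∀ {j j'} → rowOf M j ≡ rowOf M j' → j ≡ j'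
  rowOf-injective {j} {j'} same = row-unique (isOne-rowOf j) (subst (λ i → IsOne M (i , j')) (sym same) (isOne-rowOf j'))

  rowOf-surjective : ∀ i → ∃[ j ] rowOf M j ≡ i
  rowOf-surjective i = let j , one , _ = proj₁ pm i in j , sym (isOne⇒rowOf one)

rowOf-determines : ∀ {k} {M M' : Matrix k} → IsPermMatrix M → IsPermMatrix M' →
                   (∀ j → rowOf M j ≡ rowOf M' j) → M ≡ M'
rowOf-determines {M = M} {M'} pm pm' same = begin
  M                                                              ≡⟨ tabulate∘lookup M ⟨
  tabulate (λ i → lookup M i)                                    ≡⟨ tabulate-cong (λ i → tabulate∘lookup (lookup M i)) ⟨
  tabulate (λ i → tabulate (λ j → lookup (lookup M i) j))        ≡⟨ tabulate-cong (λ i → tabulate-cong (entry i)) ⟩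
  tabulate (λ i → tabulate (λ j → lookup (lookup M' i) j))       ≡⟨ tabulate-cong (λ i → tabulate∘lookup (lookup M' i)) ⟩
  tabulate (λ i → lookup M' i)                                   ≡⟨ tabulate∘lookup M' ⟩
  M'                                                             ∎
  where
  open ≡-Reasoning
  entry : ∀ i j → lookup (lookup M i) j ≡ lookup (lookup M' i) j
  entry i j with lookup (lookup M i) j in e | lookup (lookup M' i) j in e'
  ... | true  | true  = refl
  ... | false | false = refl
  ... | true  | false
    with () ← trans (sym e') (trans (cong (λ i → lookup (lookup M' i) j) (trans (isOne⇒rowOf M pm e) (same j)))
                                   (isOne-rowOf M' pm' j))
  ... | false | true
    with () ← trans (sym e) (trans (cong (λ i → lookup (lookup M i) j) (trans (isOne⇒rowOf M' pm' e') (sym (same j))))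
                                  (isOne-rowOf M pm j))

-- The identity beyond k, so that columnRow M is injective on all of ℕ.
columnRow : ∀ {k} → Matrix k → ℕ → ℕ
columnRow {k} M x with x <? k
... | yes x<k = toℕ (rowOf M (fromℕ< x<k))
... | no  _   = x

columnRow-toℕ : ∀ {k} (M : Matrix k) j → columnRow M (toℕ j) ≡ toℕ (rowOf M j)
columnRow-toℕ {k} M j with toℕ j <? k
... | yes j<k = cong (toℕ ∘ rowOf M) (fromℕ<-toℕ j j<k)
... | no  j≮k = contradiction (toℕ<n j) j≮k

columnRow-permutes : ∀ {k} (M : Matrix k) → IsPermMatrix M → Permutes k (columnRow M)
columnRow-permutes {k} M pm = record { maps-below = maps-below ; injective = injective ; covers = covers }
  where
  maps-below : ∀ {x} → x < k → columnRow M x < k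
  maps-below {x} x<k with x <? k
  ... | yes x<k = toℕ<n _
  ... | no  x≮k = contradiction x<k x≮k

  injective : ∀ {x y} → columnRow M x ≡ columnRow M y → x ≡ y
  injective {x} {y} same with x <? k | y <? k
  ... | yes x<k | yes y<k = begin
    x                     ≡⟨ toℕ-fromℕ< x<k ⟨
    toℕ (fromℕ< x<k)      ≡⟨ cong toℕ (rowOf-injective M pm (toℕ-injective same)) ⟩
    toℕ (fromℕ< y<k)      ≡⟨ toℕ-fromℕ< y<k ⟩
    y                     ∎
    where open ≡-Reasoning
  ... | yes x<k | no  y≮k = contradiction (subst (_< k) same (toℕ<n _)) y≮k
  ... | no  x≮k | yes y<k = contradiction (subst (_< k) (sym same) (toℕ<n _)) x≮k
  ... | no  _   | no  _   = same

  covers : ∀ {i} → i < k → ∃[ x ] (x < k × columnRow M x ≡ i)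
  covers {i} i<k = let j , rowOf-j≡i = rowOf-surjective M pm (fromℕ< i<k) in
    toℕ j , toℕ<n j , trans (columnRow-toℕ M j) (trans (cong toℕ rowOf-j≡i) (toℕ-fromℕ< i<k))

columnRow-determines : ∀ {k} {M M' : Matrix k} → IsPermMatrix M → IsPermMatrix M' →
                       (∀ {x} → x < k → columnRow M x ≡ columnRow M' x) → M ≡ M'
columnRow-determines {M = M} {M'} pm pm' same = rowOf-determines pm pm' λ j →
  toℕ-injective (trans (sym (columnRow-toℕ M j)) (trans (same (toℕ<n j)) (columnRow-toℕ M' j)))

RowDifference : ℤ → ℕ → ℕ → Set
RowDifference A y i = + i - + y ≡ A

rowDifference-unique : ∀ {A y y' i} → RowDifference A y i → RowDifference A y' i → y ≡ y'
rowDifference-unique {A} {y} {y'} {i} i-y≡A i-y'≡A = ℤ.+-injective (begin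
  + y                ≡⟨ i≡j-[j-i] (+ y) (+ i) ⟩
  + i - (+ i - + y)  ≡⟨ cong (λ d → + i - d) (trans i-y≡A (sym i-y'≡A)) ⟩
  + i - (+ i - + y') ≡⟨ i≡j-[j-i] (+ y') (+ i) ⟨
  + y'               ∎)
  where
  open ≡-Reasoning
  i≡j-[j-i] : ∀ i j → i ≡ j - (j - i)
  i≡j-[j-i] = ℤ-Solver.solve-∀

[+m]-[+n]≡+d⇒m≡n+d : ∀ {m n d} → + m - + n ≡ + d → m ≡ n + d
[+m]-[+n]≡+d⇒m≡n+d {m} {n} {d} m-n≡d = ℤ.+-injective (begin
  + m               ≡⟨ i≡j+[i-j] (+ m) (+ n) ⟩
  + n ℤ.+ (+ m - + n) ≡⟨ cong (λ d → + n ℤ.+ d) m-n≡d ⟩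
  + (n + d)       ∎)
  where
  open ≡-Reasoning
  i≡j+[i-j] : ∀ i j → i ≡ j ℤ.+ (i - j)
  i≡j+[i-j] = ℤ-Solver.solve-∀

dist-swap : ∀ {k} (p q : Pos k) → dist q p ≡ Product.map (-_) (-_) (dist p q)
dist-swap (i₁ , j₁) (i₂ , j₂) = cong₂ _,_ (j-i≡-[i-j] (toℤ i₂) (toℤ i₁)) (j-i≡-[i-j] (toℤ j₂) (toℤ j₁))
  where
  j-i≡-[i-j] : ∀ i j → j - i ≡ - (i - j)
  j-i≡-[i-j] = ℤ-Solver.solve-∀

RRepeated-neg : ∀ {k} {M : Matrix k} {r A B} → RRepeated M r (A , B) → RRepeated M r (- A , - B)
RRepeated-neg {M = M} {r} {A} {B} (ps , ps! , pairs , r≤|ps|) =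
  map swap ps ,
  Unique.map⁺ (λ { {_ , _} {_ , _} refl → refl }) ps! ,
  All.map⁺ (All.map reverse pairs) ,
  subst (r ≤_) (sym (length-map swap ps)) r≤|ps|
  where
  reverse : ∀ {pq} → PairWith M (A , B) pq → PairWith M (- A , - B) (swap pq)
  reverse {p , q} (one-p , one-q , p≢q , dist≡) =
    one-q , one-p , (λ q≡p → p≢q (sym q≡p)) , trans (dist-swap p q) (cong (Product.map (-_) (-_)) dist≡)

normalise : ∀ {k} (M : Matrix k) {r} → IsPermMatrix M → 1 ≤ r → HasRepetition M r →
            ∃[ A ] ∃[ b ] RRepeated M r (A , + suc b)
normalise M pm 1≤r ((A , + suc b)  , rep) = A , b , rep
normalise M pm 1≤r ((A , -[1+ b ]) , rep) = - A , b , RRepeated-neg {M = M} rep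
normalise M pm 1≤r ((A , + zero) , [] , _ , _ , r≤0) = contradiction (≤-trans 1≤r r≤0) λ ()
normalise M pm 1≤r ((A , + zero) , ((i₁ , j₁) , (i₂ , j₂)) ∷ _ , _ , (one₁ , one₂ , p≢q , dist≡) ∷ _ , _)
  with refl ← toℕ-injective (trans ([+m]-[+n]≡+d⇒m≡n+d (cong proj₂ dist≡)) (+-identityʳ (toℕ j₁)))
  with refl ← column-unique M pm one₁ one₂ = contradiction refl p≢q

endRow : ∀ {k} → Pos k × Pos k → ℕ
endRow (_ , (i₂ , _)) = toℕ i₂

module _ {k : ℕ} (M : Matrix k) (pm : IsPermMatrix M) {A : ℤ} {b : ℕ} where
  open Encoding k b (RowDifference A) using (PairEnd)

  pairWith⇒PairEnd : ∀ {pq} → PairWith M (A , + b) pq → PairEnd (columnRow M) (endRow pq)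
  pairWith⇒PairEnd {(i₁ , j₁) , (i₂ , j₂)} (one₁ , one₂ , _ , dist≡) =
    toℕ j₁ ,
    subst (_< k) j₂≡j₁+b (toℕ<n j₂) ,
    trans (cong (columnRow M) (sym j₂≡j₁+b)) (row-at one₂) ,
    trans (cong (λ y → + toℕ i₂ - + y) (row-at one₁)) (cong proj₁ dist≡)
    where
    j₂≡j₁+b : toℕ j₂ ≡ toℕ j₁ + b
    j₂≡j₁+b = [+m]-[+n]≡+d⇒m≡n+d (cong proj₂ dist≡)
    row-at : ∀ {i j} → IsOne M (i , j) → columnRow M (toℕ j) ≡ toℕ i
    row-at {j = j} one = trans (columnRow-toℕ M j) (cong toℕ (sym (isOne⇒rowOf M pm one)))

  endRow-injective : ∀ {pq pq'} → PairWith M (A , + b) pq → PairWith M (A , + b) pq' →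
                     endRow pq ≡ endRow pq' → pq ≡ pq'
  endRow-injective {(i₁ , j₁) , (i₂ , j₂)} {(i₁' , j₁') , (i₂' , j₂')}
                   (one₁ , one₂ , _ , dist≡) (one₁' , one₂' , _ , dist≡') same-row
    with refl ← toℕ-injective same-row
    with refl ← row-unique M pm one₂ one₂'
    with refl ← toℕ-injective (+-cancelʳ-≡ b (toℕ j₁) (toℕ j₁')
                  (trans (sym ([+m]-[+n]≡+d⇒m≡n+d (cong proj₂ dist≡))) ([+m]-[+n]≡+d⇒m≡n+d (cong proj₂ dist≡'))))
    with refl ← column-unique M pm one₁ one₁' = refl

  pairEnds : ∀ {r} → RRepeated M r (A , + b) →
             ∃[ W ] (Unique W × r ≤ length W × All (PairEnd (columnRow M)) W)
  pairEnds {r} (ps , ps! , pairs , r≤|ps|) =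
    map endRow ps ,
    Unique-map⁺ (λ pq∈ pq'∈ → endRow-injective (All.lookup pairs pq∈) (All.lookup pairs pq'∈)) ps! ,
    subst (r ≤_) (sym (length-map endRow ps)) r≤|ps| ,
    All.map⁺ (All.map pairWith⇒PairEnd pairs)

-- Counting matrices with an r-repetition

rowDifferences : ℕ → List ℤ
rowDifferences k = map +_ (upTo k) ++ map (λ a → - + a) (upTo k)

length-rowDifferences : ∀ k → length (rowDifferences k) ≡ 2 * k
length-rowDifferences k = begin
  length (map +_ (upTo k) ++ map (λ a → - + a) (upTo k))
    ≡⟨ length-++ (map +_ (upTo k)) ⟩
  length (map +_ (upTo k)) + length (map (λ a → - + a) (upTo k))
    ≡⟨ cong₂ _+_ (length-map +_ (upTo k)) (length-map _ (upTo k)) ⟩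
  length (upTo k) + length (upTo k)
    ≡⟨ cong (λ n → n + n) (length-upTo k) ⟩
  k + k
    ≡⟨ cong (λ n → k + n) (+-identityʳ k) ⟨
  2 * k
    ∎
  where open ≡-Reasoning

rowDifference∈rowDifferences : ∀ {k A y i} → y < k → i < k → RowDifference A y i → A ∈ rowDifferences k
rowDifference∈rowDifferences {k} {y = y} {i} y<k i<k refl with y ≤? i
... | yes y≤i = ∈-++⁺ˡ (subst (_∈ map +_ (upTo k)) (sym (trans (m-n≡m⊖n i y) (⊖-≥ y≤i)))
                                 (∈-map⁺ +_ (∈-upTo⁺ (≤-<-trans (m∸n≤m i y) i<k))))
... | no  y≰i = ∈-++⁺ʳ (map +_ (upTo k)) (subst (_∈ map (λ a → - + a) (upTo k)) (sym (trans (m-n≡m⊖n i y) (⊖-< (≰⇒> y≰i))))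
                                 (∈-map⁺ (λ a → - + a) (∈-upTo⁺ (≤-<-trans (m∸n≤m y i) y<k))))

Code : Set
Code = (ℤ × ℕ) × List ℕ

codes : ℕ → List Code
codes k = cartesianProduct (cartesianProduct (rowDifferences k) (upTo k)) (arrangements k (upTo k))

length-codes : ∀ k → length (codes k) ≡ 2 * k ^ 2 * k !
length-codes k = begin
  length (codes k)
    ≡⟨ length-cartesianProduct (cartesianProduct (rowDifferences k) (upTo k)) (arrangements k (upTo k)) ⟩
  length (cartesianProduct (rowDifferences k) (upTo k)) * length (arrangements k (upTo k))
    ≡⟨ cong₂ _*_ (length-cartesianProduct (rowDifferences k) (upTo k)) (length-arrangements k (upTo⁺ k) (length-upTo k)) ⟩
  length (rowDifferences k) * length (upTo k) * k !
    ≡⟨ cong₂ (λ m n → m * n * k !) (length-rowDifferences k) (length-upTo k) ⟩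
  2 * k * k * k !
    ≡⟨ cong (_* k !) (*-assoc 2 k k) ⟩
  2 * (k * k) * k !
    ≡⟨ cong (λ n → 2 * (k * n) * k !) (*-identityʳ k) ⟨
  2 * k ^ 2 * k !
    ∎
  where open ≡-Reasoning

module _ {k : ℕ} where
  PairEnd : ℕ → ℤ → (ℕ → ℕ) → ℕ → Set
  PairEnd b A = Encoding.PairEnd k b (RowDifference A)

  encode : ℕ → ℤ → (ℕ → ℕ) → List ℕ → List ℕ
  encode b A = Encoding.encode k b (RowDifference A)

  Witness : Set
  Witness = Matrix k × (ℤ × ℕ) × List ℕ

  code : Witness → Code
  code (M , (A , b) , P) = (A , b) , encode b A (columnRow M) P

  module _ {r : ℕ} where

    record RepetitionRows (M : Matrix k) : Set where
      field
        isPerm : IsPermMatrix M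
        A      : ℤ
        b      : ℕ
        rows   : List ℕ
        b>0    : 0 < b
        rows!  : Unique rows
        |rows| : length rows ≡ r
        ends   : All (PairEnd b A (columnRow M)) rows

    repetitionRows : 1 ≤ r → ∀ {M} → IsPermMatrix M × HasRepetition M r → RepetitionRows M
    repetitionRows 1≤r {M} (pm , rep) with A , b , rep' ← normalise M pm 1≤r rep
      with W , W! , r≤|W| , ends ← pairEnds M pm rep' = record
      { isPerm = pm ; A = A ; b = suc b ; rows = take r W ; b>0 = s≤s z≤n
      ; rows! = Unique.take⁺ r W!
      ; |rows| = trans (length-take r W) (m≤n⇒m⊓n≡m r≤|W|)
      ; ends = All.take⁺ r ends
      }

    IsWitness : Witness → Set
    IsWitness (M , (A , b) , P) =
      IsPermMatrix M × 0 < b × Unique P × length P ≡ r × All (PairEnd b A (columnRow M)) P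

    code-injective : ∀ {w w'} → IsWitness w → IsWitness w' → code w ≡ code w' → w ≡ w'
    code-injective {M , (A , b) , P} {M' , _ , P'} (pm , b>0 , _ , |P| , ends) (pm' , _ , _ , |P'| , ends') same
      with refl ← cong proj₁ same
      with refl , agree ← Encoding.encode-injective k b (RowDifference A) rowDifference-unique b>0
                            (columnRow-permutes M pm) (columnRow-permutes M' pm') ends ends'
                            (trans |P| (sym |P'|)) (cong proj₂ same)
      with refl ← columnRow-determines pm pm' agree = refl

    code∈codes : ∀ {w} → 1 ≤ r → IsWitness w → code w ∈ codes k
    code∈codes {M , (A , b) , []} 1≤r (_ , _ , _ , refl , _) = contradiction 1≤r λ ()
    code∈codes {M , (A , b) , P@(i ∷ _)} 1≤r (pm , _ , P! , _ , ends@((j , j+b<k , refl , diff) ∷ _)) =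
      ∈-cartesianProduct⁺ (∈-cartesianProduct⁺ A∈ (∈-upTo⁺ (≤-<-trans (m≤n+m b j) j+b<k)))
                          (Encoding.encode∈arrangements k b (RowDifference A) perm ends P!)
      where
      perm = columnRow-permutes M pm
      open Permutes perm
      A∈ : A ∈ rowDifferences k
      A∈ = rowDifference∈rowDifferences (maps-below (≤-<-trans (m≤m+n j b) j+b<k)) (maps-below j+b<k) diff

    block : ∀ M → RepetitionRows M → List Witness
    block M R = map (λ P → M , (A , b) , P) (arrangements r rows)
      where open RepetitionRows R

    module _ {M : Matrix k} (R : RepetitionRows M) where
      open RepetitionRows R

      length-block : length (block M R) ≡ r !
      length-block = trans (length-map _ (arrangements r rows)) (length-arrangements r rows! |rows|)

      block-unique : Unique (block M R)
      block-unique = Unique.map⁺ (λ { refl → refl }) (arrangements-unique r rows!)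

      ∈-block⁻ : ∀ {w} → w ∈ block M R → proj₁ w ≡ M × IsWitness w
      ∈-block⁻ w∈ with P , P∈ , refl ← ∈-map⁻ _ w∈ with P! , P⊆rows , |P| ← ∈-arrangements⁻ r P∈ =
        refl , isPerm , b>0 , P! , |P| , All.tabulate (All.lookup ends ∘ P⊆rows)

    witnesses : ∀ {L} → All RepetitionRows L → List Witness
    witnesses {[]}    []       = []
    witnesses {M ∷ L} (R ∷ Rs) = block M R ++ witnesses Rs

    length-witnesses : ∀ {L} (Rs : All RepetitionRows L) → length (witnesses Rs) ≡ length L * r !
    length-witnesses {[]}    []       = refl
    length-witnesses {M ∷ L} (R ∷ Rs) =
      trans (length-++ (block M R)) (cong₂ _+_ (length-block R) (length-witnesses Rs))

    ∈-witnesses⁻ : ∀ {L} (Rs : All RepetitionRows L) {w} → w ∈ witnesses Rs → proj₁ w ∈ L × IsWitness w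
    ∈-witnesses⁻ {M ∷ L} (R ∷ Rs) w∈ with ∈-++⁻ (block M R) w∈
    ... | inj₁ w∈block with refl , is-witness ← ∈-block⁻ R w∈block = here refl , is-witness
    ... | inj₂ w∈rest  with M'∈L , is-witness ← ∈-witnesses⁻ Rs w∈rest = there M'∈L , is-witness

    witnesses-unique : ∀ {L} → Unique L → (Rs : All RepetitionRows L) → Unique (witnesses Rs)
    witnesses-unique {[]}    []          []       = []
    witnesses-unique {M ∷ L} (M∉L ∷ L!) (R ∷ Rs) = Unique.++⁺ (block-unique R) (witnesses-unique L! Rs)
      λ (w∈block , w∈rest) → All.lookup M∉L (subst (_∈ L) (proj₁ (∈-block⁻ R w∈block)) (proj₁ (∈-witnesses⁻ Rs w∈rest))) refl

    repetition-count : 1 ≤ r → ∀ {L} → Unique L → All (λ M → IsPermMatrix M × HasRepetition M r) L →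
                       length L * r ! ≤ 2 * k ^ 2 * k !
    repetition-count 1≤r {L} L! repeating = begin
      length L * r !        ≡⟨ length-witnesses Rs ⟨
      length (witnesses Rs) ≤⟨ length≤-by-injection code (witnesses-unique L! Rs)
                                 (λ w∈ w'∈ → code-injective (is-witness w∈) (is-witness w'∈))
                                 (code∈codes 1≤r ∘ is-witness) ⟩
      length (codes k)      ≡⟨ length-codes k ⟩
      2 * k ^ 2 * k !       ∎
      where
      open ≤-Reasoning
      Rs : All RepetitionRows L
      Rs = All.map (repetitionRows 1≤r) repeating
      is-witness : ∀ {w} → w ∈ witnesses Rs → IsWitness w
      is-witness = proj₂ ∘ ∈-witnesses⁻ Rs

-- The threshold against factorials

n<2^n : ∀ n → n < 2 ^ n
n<2^n zero    = z<s
n<2^n (suc n) = begin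
  suc (suc n)           ≡⟨ +-comm 1 (suc n) ⟩
  suc n + 1             ≤⟨ +-mono-≤ (n<2^n n) (m^n>0 2 n) ⟩
  2 ^ n + 2 ^ n         ≡⟨ cong (λ x → 2 ^ n + x) (+-identityʳ (2 ^ n)) ⟨
  2 ^ suc n             ∎
  where open ≤-Reasoning

binary-log : ∀ {x} → 0 < x → ∃[ L ] (2 ^ L ≤ x × x < 2 ^ suc L)
binary-log {x} 0<x = below x (n<2^n x)
  where
  below : ∀ N → x < 2 ^ N → ∃[ L ] (2 ^ L ≤ x × x < 2 ^ suc L)
  below zero    x<1 = contradiction (<-≤-trans 0<x (s≤s⁻¹ x<1)) (<-irrefl refl)
  below (suc N) x<2^[1+N] with x <? 2 ^ N
  ... | yes x<2^N = below N x<2^N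
  ... | no  x≮2^N = N , ≮⇒≥ x≮2^N , x<2^[1+N]

2^a≤x<2^[1+b]⇒a≤b : ∀ {a b x} → 2 ^ a ≤ x → x < 2 ^ suc b → a ≤ b
2^a≤x<2^[1+b]⇒a≤b {a} {b} 2^a≤x x<2^[1+b] with a ≤? b
... | yes a≤b = a≤b
... | no  a≰b = contradiction (<-≤-trans x<2^[1+b] (≤-trans (^-monoʳ-≤ 2 (≰⇒> a≰b)) 2^a≤x)) (<-irrefl refl)

ceiling-quotient : ∀ c N .{{_ : NonZero c}} → 0 < N → ∃[ t ] (c * t < N × N ≤ c * suc t)
ceiling-quotient c (suc N) _ = N / c , c*t<1+N , 1+N≤c*[1+t]
  where
  open ≤-Reasoning
  c*t<1+N : c * (N / c) < suc N
  c*t<1+N = s≤s (begin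
    c * (N / c) ≡⟨ *-comm c (N / c) ⟩
    N / c * c   ≤⟨ m/n*n≤m N c ⟩
    N           ∎)
  1+N≤c*[1+t] : suc N ≤ c * suc (N / c)
  1+N≤c*[1+t] = begin
    suc N                 ≡⟨ cong suc (m≡m%n+[m/n]*n N c) ⟩
    suc (N % c + N / c * c) ≤⟨ +-monoˡ-≤ (N / c * c) (m%n<n N c) ⟩
    c + N / c * c         ≡⟨ cong (λ x → c + x) (*-comm (N / c) c) ⟩
    c + c * (N / c)       ≡⟨ *-suc c (N / c) ⟨
    c * suc (N / c)       ∎

power≤factorial : ∀ m d → m ^ d ≤ (m + d) !
power≤factorial m zero    = subst (λ n → 1 ≤ n !) (sym (+-identityʳ m)) (1≤n! m)
power≤factorial m (suc d) = begin
  m * m ^ d             ≤⟨ *-mono-≤ (≤-trans (m≤m+n m d) (n≤1+n (m + d))) (power≤factorial m d) ⟩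
  suc (m + d) * (m + d) ! ≡⟨ cong _! (+-suc m d) ⟨
  (m + suc d) !         ∎
  where open ≤-Reasoning

8e+23≤2^e : ∀ {e} → 7 ≤ e → 8 * e + 23 ≤ 2 ^ e
8e+23≤2^e {e} 7≤e = subst (λ e → 8 * e + 23 ≤ 2 ^ e) (m+[n∸m]≡n 7≤e) (from-7 (e ∸ 7))
  where
  open ≤-Reasoning
  from-7 : ∀ d → 8 * (7 + d) + 23 ≤ 2 ^ (7 + d)
  from-7 zero    = m≤m+n 79 49
  from-7 (suc d) = begin
    8 * (7 + suc d) + 23          ≡⟨ 8[7+[1+d]]+23≡8[7+d]+23+8 d ⟩
    (8 * (7 + d) + 23) + 8        ≤⟨ +-mono-≤ (from-7 d) 8≤2^[7+d] ⟩
    2 ^ (7 + d) + 2 ^ (7 + d)     ≡⟨ cong (λ x → 2 ^ (7 + d) + x) (+-identityʳ _) ⟨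
    2 ^ (7 + suc d)               ∎
    where
    8[7+[1+d]]+23≡8[7+d]+23+8 : ∀ d → 8 * (7 + suc d) + 23 ≡ (8 * (7 + d) + 23) + 8
    8[7+[1+d]]+23≡8[7+d]+23+8 = solve-∀
    8[7+d]+15+8≡8[7+d]+23 : ∀ d → 8 * (7 + d) + 15 + 8 ≡ 8 * (7 + d) + 23
    8[7+d]+15+8≡8[7+d]+23 = solve-∀
    8≤2^[7+d] : 8 ≤ 2 ^ (7 + d)
    8≤2^[7+d] = ≤-trans (m≤n+m 8 (8 * (7 + d) + 15)) (≤-trans (≤-reflexive (8[7+d]+15+8≡8[7+d]+23 d)) (from-7 d))

log-slack : ∀ {Q} → 128 ≤ Q → ∃[ e ] (2 * Q ≤ 2 ^ e × 8 * e + 7 ≤ Q)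
log-slack {Q} 128≤Q with E , 2^E≤Q , Q<2^[1+E] ← binary-log (<-≤-trans z<s 128≤Q) =
  2 + E , *-monoʳ-≤ 2 (<⇒≤ Q<2^[1+E]) , (begin
    8 * (2 + E) + 7 ≡⟨ 8[2+E]+7≡8E+23 E ⟩
    8 * E + 23      ≤⟨ 8e+23≤2^e {E} (2^a≤x<2^[1+b]⇒a≤b 128≤Q Q<2^[1+E]) ⟩
    2 ^ E           ≤⟨ 2^E≤Q ⟩
    Q               ∎)
  where
  open ≤-Reasoning
  8[2+E]+7≡8E+23 : ∀ E → 8 * (2 + E) + 7 ≡ 8 * E + 23
  8[2+E]+7≡8E+23 = solve-∀

7[1+Q]≤8[Q∸e] : ∀ {Q e} → 8 * e + 7 ≤ Q → 7 * suc Q ≤ 8 * (Q ∸ e)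
7[1+Q]≤8[Q∸e] {Q} {e} 8e+7≤Q = +-cancelʳ-≤ (8 * e) (7 * suc Q) (8 * (Q ∸ e)) (begin
  7 * suc Q + 8 * e         ≡⟨ 7[1+Q]+8e≡7Q+[8e+7] Q e ⟩
  7 * Q + (8 * e + 7)       ≤⟨ +-monoʳ-≤ (7 * Q) 8e+7≤Q ⟩
  7 * Q + Q                 ≡⟨ 7Q+Q≡8Q Q ⟩
  8 * Q                     ≡⟨ cong (8 *_) (m∸n+n≡m e≤Q) ⟨
  8 * (Q ∸ e + e)           ≡⟨ *-distribˡ-+ 8 (Q ∸ e) e ⟩
  8 * (Q ∸ e) + 8 * e       ∎)
  where
  open ≤-Reasoning
  e≤Q : e ≤ Q
  e≤Q = ≤-trans (≤-trans (m≤n*m e 8) (m≤m+n (8 * e) 7)) 8e+7≤Q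
  7[1+Q]+8e≡7Q+[8e+7] : ∀ Q e → 7 * suc Q + 8 * e ≡ 7 * Q + (8 * e + 7)
  7[1+Q]+8e≡7Q+[8e+7] = solve-∀
  7Q+Q≡8Q : ∀ Q → 7 * Q + Q ≡ 8 * Q
  7Q+Q≡8Q = solve-∀

2[Q∸e]2^[Q∸e]≤L : ∀ {Q L e} → 2 ^ Q ≤ L → 2 * Q ≤ 2 ^ e → e ≤ Q → 2 * ((Q ∸ e) * 2 ^ (Q ∸ e)) ≤ L
2[Q∸e]2^[Q∸e]≤L {Q} {L} {e} 2^Q≤L 2Q≤2^e e≤Q = begin
  2 * (t * 2 ^ t)   ≤⟨ *-monoʳ-≤ 2 (*-monoˡ-≤ (2 ^ t) (m∸n≤m Q e)) ⟩
  2 * (Q * 2 ^ t)   ≡⟨ *-assoc 2 Q (2 ^ t) ⟨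
  2 * Q * 2 ^ t     ≤⟨ *-monoˡ-≤ (2 ^ t) 2Q≤2^e ⟩
  2 ^ e * 2 ^ t     ≡⟨ ^-distribˡ-+-* 2 e t ⟨
  2 ^ (e + t)       ≡⟨ cong (2 ^_) (m+[n∸m]≡n e≤Q) ⟩
  2 ^ Q             ≤⟨ 2^Q≤L ⟩
  L                 ∎
  where
  open ≤-Reasoning
  t : ℕ
  t = Q ∸ e

-- Use m ^ (r ∸ m) ≤ r ! with m = 2 ^ (Q ∸ e): m is small against r ≈ 4L / Q, while log₂ m = Q ∸ e is close to Q.
factorial-lower-bound : ∀ {Q L e r} → 2 ^ Q ≤ L → 2 * Q ≤ 2 ^ e → 8 * e + 7 ≤ Q → 4 * L ≤ suc Q * r →
                        2 ^ (3 * L) ≤ r !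
factorial-lower-bound {Q} {L} {e} {r} 2^Q≤L 2Q≤2^e 8e+7≤Q 4L≤[1+Q]r = begin
  2 ^ (3 * L)        ≤⟨ ^-monoʳ-≤ 2 3L≤t[r∸m] ⟩
  2 ^ (t * (r ∸ m))  ≡⟨ ^-*-assoc 2 t (r ∸ m) ⟨
  m ^ (r ∸ m)        ≤⟨ power≤factorial m (r ∸ m) ⟩
  (m + (r ∸ m)) !    ≡⟨ cong _! (m+[n∸m]≡n m≤r) ⟩
  r !                ∎
  where
  open ≤-Reasoning
  t m : ℕ
  t = Q ∸ e
  m = 2 ^ t

  2tm≤L : 2 * (t * m) ≤ L
  2tm≤L = 2[Q∸e]2^[Q∸e]≤L 2^Q≤L 2Q≤2^e (≤-trans (≤-trans (m≤n*m e 8) (m≤m+n (8 * e) 7)) 8e+7≤Q)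

  7L≤2tr : 7 * L ≤ 2 * (t * r)
  7L≤2tr = *-cancelˡ-≤ (4 * suc Q) (begin
    4 * suc Q * (7 * L)        ≡⟨ 4[1+Q][7L]≡7[1+Q][4L] Q L ⟩
    7 * suc Q * (4 * L)        ≤⟨ *-mono-≤ (7[1+Q]≤8[Q∸e] {Q} {e} 8e+7≤Q) 4L≤[1+Q]r ⟩
    8 * t * (suc Q * r)        ≡⟨ 8t[[1+Q]r]≡4[1+Q][2tr] t Q r ⟩
    4 * suc Q * (2 * (t * r))  ∎)
    where
    4[1+Q][7L]≡7[1+Q][4L] : ∀ Q L → 4 * suc Q * (7 * L) ≡ 7 * suc Q * (4 * L)
    4[1+Q][7L]≡7[1+Q][4L] = solve-∀
    8t[[1+Q]r]≡4[1+Q][2tr] : ∀ t Q r → 8 * t * (suc Q * r) ≡ 4 * suc Q * (2 * (t * r))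
    8t[[1+Q]r]≡4[1+Q][2tr] = solve-∀

  m≤r : m ≤ r
  m≤r with m ≤? r
  ... | yes m≤r = m≤r
  ... | no  m≰r = contradiction (begin-strict
    L            <⟨ m<m*n L 7 (s≤s (s≤s z≤n)) ⟩
    L * 7        ≡⟨ *-comm L 7 ⟩
    7 * L        ≤⟨ 7L≤2tr ⟩
    2 * (t * r)  ≤⟨ *-monoʳ-≤ 2 (*-monoʳ-≤ t (<⇒≤ (≰⇒> m≰r))) ⟩
    2 * (t * m)  ≤⟨ 2tm≤L ⟩
    L            ∎) (<-irrefl refl)
    where instance _ = >-nonZero (<-≤-trans (m^n>0 2 Q) 2^Q≤L)

  3L≤t[r∸m] : 3 * L ≤ t * (r ∸ m)
  3L≤t[r∸m] = *-cancelˡ-≤ 2 (begin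
    2 * (3 * L)                  ≡⟨ 2[3L]≡6L L ⟩
    6 * L                        ≡⟨ m+n∸n≡m (6 * L) L ⟨
    6 * L + L ∸ L                ≡⟨ cong (_∸ L) (6L+L≡7L L) ⟩
    7 * L ∸ L                    ≤⟨ ∸-mono 7L≤2tr 2tm≤L ⟩
    2 * (t * r) ∸ 2 * (t * m)    ≡⟨ *-distribˡ-∸ 2 (t * r) (t * m) ⟨
    2 * (t * r ∸ t * m)          ≡⟨ cong (2 *_) (*-distribˡ-∸ t r m) ⟨
    2 * (t * (r ∸ m))            ∎)
    where
    2[3L]≡6L : ∀ L → 2 * (3 * L) ≡ 6 * L
    2[3L]≡6L = solve-∀
    6L+L≡7L : ∀ L → 6 * L + L ≡ 7 * L
    6L+L≡7L = solve-∀

¬ThresholdOK : ∀ {k L r} → k < 2 ^ suc L → suc L ^ r < k ^ 4 → ¬ ThresholdOK k r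
¬ThresholdOK {k} {L} {r} k<2^[1+L] [1+L]^r<k^4 threshold = <⇒≱ k<2^[1+L] (begin
  2 ^ suc L ≤⟨ threshold (suc L) 1 z<s (subst (suc L ^ r <_) k^4≡k^4*1^r [1+L]^r<k^4) ⟩
  k ^ 1     ≡⟨ *-identityʳ k ⟩
  k         ∎)
  where
  open ≤-Reasoning
  k^4≡k^4*1^r : k ^ 4 ≡ k ^ 4 * 1 ^ r
  k^4≡k^4*1^r = trans (sym (*-identityʳ (k ^ 4))) (cong (k ^ 4 *_) (sym (^-zeroˡ r)))

-- The witness a / b = (L + 1) / 1 > log₂ k refutes the threshold as long as (L + 1) ^ r < k ^ 4.
below-threshold : ∀ {k L Q t r} → 2 ^ L ≤ k → k < 2 ^ suc L → L < 2 ^ suc Q → suc Q * t < 4 * L →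
                  r ≤ t → ¬ ThresholdOK k r
below-threshold {k} {L} {Q} {t} {r} 2^L≤k k<2^[1+L] L<2^[1+Q] [1+Q]t<4L r≤t =
  ¬ThresholdOK {k} {L} {r} k<2^[1+L] (begin-strict
    suc L ^ r          ≤⟨ ^-monoˡ-≤ r L<2^[1+Q] ⟩
    (2 ^ suc Q) ^ r    ≡⟨ ^-*-assoc 2 (suc Q) r ⟩
    2 ^ (suc Q * r)    ≤⟨ ^-monoʳ-≤ 2 (*-monoʳ-≤ (suc Q) r≤t) ⟩
    2 ^ (suc Q * t)    <⟨ ^-monoʳ-< 2 (s≤s (s≤s z≤n)) [1+Q]t<4L ⟩
    2 ^ (4 * L)        ≡⟨ cong (2 ^_) (*-comm 4 L) ⟩
    2 ^ (L * 4)        ≡⟨ ^-*-assoc 2 L 4 ⟨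
    (2 ^ L) ^ 4        ≤⟨ ^-monoˡ-≤ 4 2^L≤k ⟩
    k ^ 4              ∎)
  where open ≤-Reasoning

[1+n]*2k²≤2^[3L] : ∀ {n k L} → k < 2 ^ suc L → n + 3 ≤ L → suc n * (2 * k ^ 2) ≤ 2 ^ (3 * L)
[1+n]*2k²≤2^[3L] {n} {k} {L} k<2^[1+L] n+3≤L = begin
  suc n * (2 * k ^ 2)                ≤⟨ *-mono-≤ (n<2^n n) (*-monoʳ-≤ 2 (^-monoˡ-≤ 2 (<⇒≤ k<2^[1+L]))) ⟩
  2 ^ n * (2 * (2 ^ suc L) ^ 2)      ≡⟨ cong (λ x → 2 ^ n * (2 * x)) (^-*-assoc 2 (suc L) 2) ⟩
  2 ^ n * 2 ^ suc (suc L * 2)        ≡⟨ ^-distribˡ-+-* 2 n (suc (suc L * 2)) ⟨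
  2 ^ (n + suc (suc L * 2))          ≤⟨ ^-monoʳ-≤ 2 exponent-bound ⟩
  2 ^ (3 * L)                        ∎
  where
  open ≤-Reasoning
  exponent-bound : n + suc (suc L * 2) ≤ 3 * L
  exponent-bound = begin
    n + suc (suc L * 2)  ≡⟨ n+[1+[1+L]2]≡[n+3]+2L n L ⟩
    (n + 3) + 2 * L      ≤⟨ +-monoˡ-≤ (2 * L) n+3≤L ⟩
    L + 2 * L            ≡⟨ L+2L≡3L L ⟩
    3 * L                ∎
    where
    n+[1+[1+L]2]≡[n+3]+2L : ∀ n L → n + suc (suc L * 2) ≡ (n + 3) + 2 * L
    n+[1+[1+L]2]≡[n+3]+2L = solve-∀
    L+2L≡3L : ∀ L → L + 2 * L ≡ 3 * L
    L+2L≡3L = solve-∀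

large-binary-log : ∀ {L} → 2 ^ 128 ≤ L → ∃[ Q ] (2 ^ Q ≤ L × L < 2 ^ suc Q × 128 ≤ Q)
large-binary-log 2^128≤L =
  let Q , 2^Q≤L , L<2^[1+Q] = binary-log (<-≤-trans (m^n>0 2 128) 2^128≤L)
  in Q , 2^Q≤L , L<2^[1+Q] , 2^a≤x<2^[1+b]⇒a≤b {128} {Q} 2^128≤L L<2^[1+Q]

factorial-beats-threshold : ∀ {n k L Q} → 2 ^ L ≤ k → k < 2 ^ suc L → n + 3 ≤ L →
  2 ^ Q ≤ L → L < 2 ^ suc Q → 128 ≤ Q →
  ∃[ r₀ ] (1 ≤ r₀ × (∀ r → r < r₀ → ¬ ThresholdOK k r) × suc n * (2 * k ^ 2) ≤ r₀ !)
factorial-beats-threshold {n} {k} {L} {Q} 2^L≤k k<2^[1+L] n+3≤L 2^Q≤L L<2^[1+Q] 128≤Q =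
  let e , 2Q≤2^e , 8e+7≤Q = log-slack 128≤Q
      t , [1+Q]t<4L , 4L≤[1+Q][1+t] = ceiling-quotient (suc Q) (4 * L) (<-≤-trans (m^n>0 2 Q) (≤-trans 2^Q≤L (m≤n*m L 4)))
  in suc t , s≤s z≤n ,
     (λ r r<1+t → below-threshold {k} {L} {Q} {t} 2^L≤k k<2^[1+L] L<2^[1+Q] [1+Q]t<4L (s≤s⁻¹ r<1+t)) ,
     ≤-trans ([1+n]*2k²≤2^[3L] {n} k<2^[1+L] n+3≤L)
             (factorial-lower-bound {Q} {L} {e} {suc t} 2^Q≤L 2Q≤2^e 8e+7≤Q 4L≤[1+Q][1+t])

threshold-below-factorial : ∀ n → ∃[ K ] ∀ k → K ≤ k →
  ∃[ r₀ ] (1 ≤ r₀ × (∀ r → r < r₀ → ¬ ThresholdOK k r) × suc n * (2 * k ^ 2) ≤ r₀ !)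
threshold-below-factorial n = 2 ^ X , λ k 2^X≤k →
  let L , 2^L≤k , k<2^[1+L] = binary-log (<-≤-trans (m^n>0 2 X) 2^X≤k)
      X≤L = 2^a≤x<2^[1+b]⇒a≤b {X} {L} 2^X≤k k<2^[1+L]
      Q , 2^Q≤L , L<2^[1+Q] , 128≤Q = large-binary-log (≤-trans (m≤n+m (2 ^ 128) (n + 3)) X≤L)
  in factorial-beats-threshold {n} 2^L≤k k<2^[1+L] (≤-trans (m≤m+n (n + 3) (2 ^ 128)) X≤L) 2^Q≤L L<2^[1+Q] 128≤Q
  where
  -- log₂ k ≥ n + 3 absorbs the factor (n + 1) · 2k², and log₂ log₂ k ≥ 128 is what log-slack needs.
  X : ℕ
  X = n + 3 + 2 ^ 128

-- Matrices that are not scattered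

¬¬-All : ∀ {S : Set} {P : S → Set} {xs} → All (λ x → ¬ ¬ P x) xs → ¬ ¬ All P xs
¬¬-All []           ¬all = ¬all []
¬¬-All (¬¬p ∷ ¬¬ps) ¬all = ¬¬p λ p → ¬¬-All ¬¬ps λ ps → ¬all (p ∷ ps)

¬Scattered⇒¬¬HasRepetition : ∀ {k} {M : Matrix k} {r₀} → (∀ r → r < r₀ → ¬ ThresholdOK k r) →
                             ¬ Scattered M → ¬ ¬ HasRepetition M r₀
¬Scattered⇒¬¬HasRepetition below ¬scattered ¬repetition =
  ¬scattered λ r threshold (v , ps , ps! , pairs , r≤|ps|) →
    ¬repetition (v , ps , ps! , pairs , ≤-trans (≮⇒≥ λ r<r₀ → below r r<r₀ threshold) r≤|ps|)

a*c≤d∧b*d≤c*f⇒a*b≤f : ∀ {a b c d f} .{{_ : NonZero d}} → a * c ≤ d → b * d ≤ c * f → a * b ≤ f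
a*c≤d∧b*d≤c*f⇒a*b≤f {a} {b} {c} {d} {f} ac≤d bd≤cf = *-cancelʳ-≤ (a * b) f d (begin
  a * b * d    ≡⟨ *-assoc a b d ⟩
  a * (b * d)  ≤⟨ *-monoʳ-≤ a bd≤cf ⟩
  a * (c * f)  ≡⟨ *-assoc a c f ⟨
  a * c * f    ≤⟨ *-monoˡ-≤ f ac≤d ⟩
  d * f        ≡⟨ *-comm d f ⟩
  f * d        ∎)
  where open ≤-Reasoning

-- Not being scattered yields an r₀-repetition only up to double negation, which the decidable goal absorbs.
not-scattered-count : ∀ n → ∃[ K ] ∀ k → K ≤ k → ∀ (L : List (Matrix k)) → Unique L →
                      All (λ M → IsPermMatrix M × ¬ Scattered M) L → suc n * length L ≤ k !
not-scattered-count n = proj₁ (threshold-below-factorial n) , λ k K≤k L L! hyps →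
  let r₀ , 1≤r₀ , below , big = proj₂ (threshold-below-factorial n) k K≤k
      ¬¬repeating : ∀ {M} → IsPermMatrix M × ¬ Scattered M → ¬ ¬ (IsPermMatrix M × HasRepetition M r₀)
      ¬¬repeating {M} (pm , ¬scattered) ¬repeating =
        ¬Scattered⇒¬¬HasRepetition {M = M} below ¬scattered (λ rep → ¬repeating (pm , rep))
  in decidable-stable (suc n * length L ≤? k !) λ ¬bound →
       ¬¬-All {P = λ M → IsPermMatrix M × HasRepetition M r₀} (All.map (λ {M} → ¬¬repeating {M}) hyps) λ repeating →
         ¬bound (a*c≤d∧b*d≤c*f⇒a*b≤f {suc n} {length L} {2 * k ^ 2} {r₀ !} {{r₀ !≢0}}
                   big (repetition-count 1≤r₀ L! repeating))

theorem2p2 :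
    (∀ (k r : ℕ) → 1 ≤ r → r ≤ k →
      ∀ (L : List (Matrix k)) → Unique L →
      All (λ M → IsPermMatrix M × HasRepetition M r) L →
      length L * r ! ≤ 2 * k ^ 2 * k !)
    × (∀ (n : ℕ) → ∃[ K ] ∀ (k : ℕ) → K ≤ k →
      ∀ (L : List (Matrix k)) → Unique L →
      All (λ M → IsPermMatrix M × ¬ Scattered M) L →
      suc n * length L ≤ k !)
theorem2p2 = (λ k r 1≤r _ L → repetition-count 1≤r) , not-scattered-count
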